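{- Let $T\subset V$ satisfy $w(T)>W_U$, and let $\mathcal{F}=\{x\in\mathcal{P}: \sum_{\{i,j\}\in E(T)}x_{ij}=(|T|-1)(|T|-2)/2\}$ be the face of $\mathcal{P}$ defined by the $T$-Weight-Cover inequality $\sum_{\{i,j\}\in E(T)}x_{ij}\le (|T|-1)(|T|-2)/2$. If $\mathcal{F}\neq\emptyset$, then there exists $l\in T$ such that $w(T\setminus\{l\})\le W_U$.
   Context: Let $n,k$ be integers with $k\ge 2$, $F_L:=\lfloor n/k\rfloor\ge 2$ and $F_U:=\lceil n/k\rceil$. Let $G=(V,E)$ be the complete graph on $V=\{1,\dots,n\}$, let $w:V\to\mathbb{R}^+$ be node weights and $W_L\le W_U$ positive reals. For $x\in\{0,1\}^E$ write $x_{ij}=x_{ji}$ for the coordinate of edge $\{i,j\}$. Let $r_0=n \bmod k$ and $\beta_{n,k}=r_0F_U(F_U-1)/2+(k-r_0)F_L(F_L-1)/2$. $\mathcal{P}$ is the convex hull of all $x\in\{0,1\}^E$ satisfying: for all distinct $i<j<l$, $x_{ij}+x_{jl}-x_{il}\le1$, $x_{ij}-x_{jl}+x_{il}\le1$, $-x_{ij}+x_{jl}+x_{il}\le1$; for all $i\in V$, $F_L\le 1+\sum_{j\ne i}x_{ij}\le F_U$ and $W_L\le w_i+\sum_{j\ne i}w_jx_{ij}\le W_U$; and $\sum_{\{i,j\}\in E}x_{ij}=\beta_{n,k}$. For $T\subseteq V$, $w(T)=\sum_{i\in T}w_i$ and $E(T)$ is the set of edges with both end nodes in $T$. The inequality $\sum_{E(T)}x_{ij}\le(|T|-1)(|T|-2)/2$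 is valid for $\mathcal{P}$ when $w(T)>W_U$. -}

module Defs where

open import Level using (Level; suc; _⊔_)
open import Data.Nat as ℕ using (ℕ; zero; _∸_; _%_; _≟_)
open import Data.Nat.DivMod using (_/_)
open import Data.Bool using (Bool; true; false; if_then_else_)
open import Data.Fin using (Fin; toℕ)
open import Data.Fin.Subset using (Subset; _∈_; _-_; ∣_∣)
open import Data.Vec using (lookup)
open import Data.List using (List; []; _∷_; foldr; map; allFin)
open import Data.Product using (Σ; _×_; _,_; ∃; ∃-syntax)
open import Relation.Nullary using (¬_; does)
open import Relation.Binary using (Rel; IsTotalOrder)
open import Algebra.Bundles using (CommutativeRing)
open import Relation.Binary.PropositionalEquality using (_≡_)
open import Data.List.Relation.Unary.All using (All)

-- The real numbers are modelled by an arbitrary ordered field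
-- (ℝ is an instance; completeness is never used).

record OrderedField c ℓ₁ ℓ₂ : Set (suc (c ⊔ ℓ₁ ⊔ ℓ₂)) where
  field
    ring : CommutativeRing c ℓ₁
  open CommutativeRing ring public hiding (ring)
  field
    _≤_          : Rel Carrier ℓ₂
    isTotalOrder : IsTotalOrder _≈_ _≤_
    +-mono-≤     : ∀ {x y} z → x ≤ y → (x + z) ≤ (y + z)
    *-nonneg     : ∀ {x y} → 0# ≤ x → 0# ≤ y → 0# ≤ (x * y)
    0≉1          : ¬ (0# ≈ 1#)
    inverse      : ∀ x → ¬ (x ≈ 0#) → ∃[ y ] ((x * y) ≈ 1#)

  _<_ : Rel Carrier (ℓ₁ ⊔ ℓ₂)
  x < y = (x ≤ y) × ¬ (x ≈ y)

  fromℕ : ℕ → Carrier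
  fromℕ zero      = 0#
  fromℕ (ℕ.suc m) = 1# + fromℕ m

  sumV : ∀ {n} → (Fin n → Carrier) → Carrier
  sumV {n} f = foldr _+_ 0# (map f (allFin n))

  ind : Bool → Carrier
  ind b = if b then 1# else 0#

sumℕ : ∀ {n} → (Fin n → ℕ) → ℕ
sumℕ {n} f = foldr ℕ._+_ 0 (map f (allFin n))

bool→ℕ : Bool → ℕ
bool→ℕ b = if b then 1 else 0

_<ᵇ_ : ∀ {n} → Fin n → Fin n → Bool
i <ᵇ j = does (ℕ.suc (toℕ i) ℕ.≤? toℕ j)

_≠ᵇ_ : ∀ {n} → Fin n → Fin n → Bool
i ≠ᵇ j = if does (toℕ i ≟ toℕ j) then false else true

_∈ᵇ_ : ∀ {n} → Fin n → Subset n → Bool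
i ∈ᵇ T = lookup T i

-- A vector indexed by the edges {i,j} (i<j) of the
-- complete graph K_n is represented by a function X : Fin n → Fin n → A
-- of which only the entries X i j with i < j are meaningful; the
-- coordinate x_ij = x_ji of edge {i,j} is read off by `coord`.

coord : ∀ {a} {A : Set a} {n} → (Fin n → Fin n → A) → Fin n → Fin n → A
coord X i j = if i <ᵇ j then X i j else X j i

sumEℕ : ∀ {n} → (Fin n → Fin n → ℕ) → ℕ
sumEℕ f = sumℕ (λ i → sumℕ (λ j → if i <ᵇ j then f i j else 0))

module Params (n k : ℕ) .{{_ : ℕ.NonZero k}} where
  F_L : ℕ
  F_L = n / k
  r₀ : ℕ
  r₀ = n % k
  F_U : ℕ
  F_U = if does (r₀ ≟ 0) then F_L else ℕ.suc F_L
  β : ℕ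
  β = r₀ ℕ.* ((F_U ℕ.* (F_U ∸ 1)) / 2) ℕ.+ (k ∸ r₀) ℕ.* ((F_L ℕ.* (F_L ∸ 1)) / 2)

module Polytope {c ℓ₁ ℓ₂} (𝔽 : OrderedField c ℓ₁ ℓ₂) where
  open OrderedField 𝔽 public

  record Feasible (n k : ℕ) .{{_ : ℕ.NonZero k}}
                  (w : Fin n → Carrier) (W_L W_U : Carrier)
                  (x : Fin n → Fin n → Bool) : Set (ℓ₁ ⊔ ℓ₂) where
    open Params n k
    X : Fin n → Fin n → ℕ
    X i j = bool→ℕ (coord x i j)
    field
      -- triangle inequalities for i < j < l (rearranged over ℕ)
      tri₁ : ∀ i j l → i <ᵇ j ≡ true → j <ᵇ l ≡ true →
             X i j ℕ.+ X j l ℕ.≤ 1 ℕ.+ X i l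
      tri₂ : ∀ i j l → i <ᵇ j ≡ true → j <ᵇ l ≡ true →
             X i j ℕ.+ X i l ℕ.≤ 1 ℕ.+ X j l
      tri₃ : ∀ i j l → i <ᵇ j ≡ true → j <ᵇ l ≡ true →
             X j l ℕ.+ X i l ℕ.≤ 1 ℕ.+ X i j
      cardL : ∀ i → F_L ℕ.≤ 1 ℕ.+ sumℕ (λ j → if i ≠ᵇ j then X i j else 0)
      cardU : ∀ i → 1 ℕ.+ sumℕ (λ j → if i ≠ᵇ j then X i j else 0) ℕ.≤ F_U
      wL : ∀ i → W_L ≤ (w i + sumV (λ j → if i ≠ᵇ j then w j * fromℕ (X i j) else 0#))
      wU : ∀ i → (w i + sumV (λ j → if i ≠ᵇ j then w j * fromℕ (X i j) else 0#)) ≤ W_U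
      total : sumEℕ X ≡ β

  -- Convex hull: x ∈ 𝒫 iff x is a convex combination of feasible
  -- integral points (equality of vectors in ℝ^E, i.e. on edges i<j).
  InP : (n k : ℕ) .{{_ : ℕ.NonZero k}} (w : Fin n → Carrier) (W_L W_U : Carrier)
        (x : Fin n → Fin n → Carrier) → Set (c ⊔ ℓ₁ ⊔ ℓ₂)
  InP n k w W_L W_U x =
    Σ (List (Carrier × (Fin n → Fin n → Bool))) λ comb →
      All (λ { (λk , y) → (0# ≤ λk) × Feasible n k w W_L W_U y }) comb
    × (foldr (λ { (λk , _) acc → λk + acc }) 0# comb ≈ 1#)
    × (∀ i j → i <ᵇ j ≡ true →
         x i j ≈ foldr (λ { (λk , y) acc → λk * ind (y i j) + acc }) 0# comb)

  sumE : ∀ {n} → (Fin n → Fin n → Carrier) → Carrier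
  sumE f = sumV (λ i → sumV (λ j → if i <ᵇ j then f i j else 0#))

  wt : ∀ {n} → (Fin n → Carrier) → Subset n → Carrier
  wt w T = sumV (λ i → if i ∈ᵇ T then w i else 0#)

  sumET : ∀ {n} → Subset n → (Fin n → Fin n → Carrier) → Carrier
  sumET T x = sumE (λ i j → if i ∈ᵇ T then (if j ∈ᵇ T then x i j else 0#) else 0#)

  -- (|T|-1)(|T|-2)/2  (a natural number whenever |T| ≥ 1)
  rhsWC : ∀ {n} → Subset n → ℕ
  rhsWC T = ((∣ T ∣ ∸ 1) ℕ.* (∣ T ∣ ∸ 2)) / 2

  InFace : (n k : ℕ) .{{_ : ℕ.NonZero k}} (w : Fin n → Carrier) (W_L W_U : Carrier)
           (T : Subset n) (x : Fin n → Fin n → Carrier) → Set (c ⊔ ℓ₁ ⊔ ℓ₂)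
  InFace n k w W_L W_U T x = InP n k w W_L W_U x × (sumET T x ≈ fromℕ (rhsWC T))

-- A point x of the face is a convex combination of feasible
-- integral points y.  The left-hand side is linear in x, so on the face
-- the λ-weighted mean of e(y), the number of edges of y inside T, is the
-- integer r = (|T|-1)(|T|-2)/2; hence some y of the combination has
-- e(y) ≥ r.  A graph with that many edges inside a non-empty T has a
-- vertex i ∈ T adjacent to all of T except at most one l ∈ T: otherwise
-- every vertex of T misses two others, and double counting gives
-- 2e + 3|T| ≤ |T|², i.e. e < r.  The upper weight constraint of y at i
-- then bounds w(T ∖ {l}) by W_U.  T ≠ ∅ because w(T) > W_U ≥ W_L > 0.
module Submission where

open import Defs
open import Data.Nat as ℕ using (ℕ)
open import Data.Fin using (Fin)
open import Data.Fin.Subset using (Subset; _∈_) renaming (_-_ to _∖_)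
open import Data.Product using (_×_; ∃; ∃-syntax)

open import Data.Nat using (zero; suc; z≤n; s≤s)
open import Data.Nat.Properties using (≰⇒>; _≤?_)
import Data.Nat.Properties
open import Data.Bool using (Bool; true; false; if_then_else_; _∧_; not)
open import Data.Bool.Properties using () renaming (_≟_ to _≟ᵇ_)
open import Data.Fin using (toℕ) renaming (zero to fzero; suc to fsuc)
open import Data.Fin.Properties using (toℕ-injective; any?)
open import Data.Fin.Subset using (_─_; ⁅_⁆; ⊥; inside; outside; _∉_; Nonempty; ∣_∣)
open import Data.Fin.Subset.Properties using (nonempty?; Empty-unique; p─q⊆p; x∈⁅x⁆)
open import Data.Vec using ([]; _∷_; here; there)
open import Data.Vec.Properties using (lookup⇒[]=; []=⇒lookup; lookup-replicate)
open import Data.List using (List; []; _∷_; foldr; map; tabulate; allFin)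
open import Data.List.Properties using (map-tabulate)
open import Data.List.Relation.Unary.All using (All; []; _∷_; lookupAny; zipWith)
open import Data.List.Relation.Unary.All.Properties using (¬Any⇒All¬)
import Data.List.Relation.Unary.Any as Any
open import Data.Product using (_,_; proj₁; proj₂)
open import Data.Sum using (_⊎_; inj₁; inj₂)
open import Data.Empty using (⊥-elim)
open import Relation.Nullary using (¬_; yes; no; contradiction)
open import Relation.Nullary.Decidable using (dec-true; dec-false; _×-dec_)
open import Relation.Binary using (tri<; tri≈; tri>; IsTotalOrder; Poset)
open import Relation.Binary.PropositionalEquality
  using (_≡_; _≢_; refl; sym; trans; cong; cong₂; subst; subst₂; module ≡-Reasoning)
open import Function using (_∘_)
open import Algebra.Bundles using (CommutativeRing)
import Algebra.Properties.Semiring.Sum as SemiringSum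
import Relation.Binary.Reasoning.Setoid as SetoidReasoning
import Relation.Binary.Reasoning.PartialOrder as PosetReasoning

module Combinatorics where

  open import Data.Nat using (_+_; _*_; _∸_; _≤_; _<_)
  open import Data.Nat.Properties
    using (<-cmp; ≤-trans; +-comm; +-assoc; +-identityʳ; *-identityˡ; m≤m+n; m≤n+m;
           +-mono-≤; +-monoʳ-≤; +-monoˡ-≤; +-cancelʳ-≤; n≤0⇒n≡0; n<1⇒n≡0; <⇒≱;
           module ≤-Reasoning)
    renaming (+-*-semiring to ℕ-semiring)
  open import Data.Nat.DivMod using (_/_; m*n/n≡m; /-monoˡ-≤)
  open import Data.Nat.Tactic.RingSolver using (solve-∀)
  open import Algebra.Properties.Semiring.Sum ℕ-semiring
    using () renaming (sum to ∑ℕ; sum-cong-≋ to ∑ℕ-cong; ∑-distrib-+ to ∑ℕ-distrib-+; ∑-comm to ∑ℕ-comm;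
                       *-distribˡ-sum to *-distribˡ-∑ℕ; *-distribʳ-sum to *-distribʳ-∑ℕ)

  bool→ℕ-∧ : ∀ a b → bool→ℕ (a ∧ b) ≡ bool→ℕ a * bool→ℕ b
  bool→ℕ-∧ false b = refl
  bool→ℕ-∧ true  b = sym (+-identityʳ (bool→ℕ b))

  bool→ℕ-∧₃ : ∀ a b c → bool→ℕ (a ∧ b ∧ c) ≡ bool→ℕ a * (bool→ℕ b * bool→ℕ c)
  bool→ℕ-∧₃ a b c = trans (bool→ℕ-∧ a (b ∧ c)) (cong (bool→ℕ a *_) (bool→ℕ-∧ b c))

  bool→ℕ-∧₄ : ∀ a b c d → bool→ℕ (a ∧ b ∧ c ∧ d) ≡ bool→ℕ a * (bool→ℕ b * (bool→ℕ c * bool→ℕ d))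
  bool→ℕ-∧₄ a b c d = trans (bool→ℕ-∧ a (b ∧ c ∧ d)) (cong (bool→ℕ a *_) (bool→ℕ-∧₃ b c d))

  -- Relative to a vertex i of a graph, a member j of a set (s) is a
  -- neighbour (d ∧ g), a non-neighbour (d ∧ not g) or i itself (not d).
  indicator-partition : ∀ s d g →
    bool→ℕ (s ∧ d ∧ g) + bool→ℕ (s ∧ d ∧ not g) + bool→ℕ (not d ∧ s) ≡ bool→ℕ s
  indicator-partition true  true  true  = refl
  indicator-partition true  true  false = refl
  indicator-partition true  false _     = refl
  indicator-partition false true  _     = refl
  indicator-partition false false _     = refl

  indicator-head : ∀ a b → 1 ≤ bool→ℕ (a ∧ b) → a ≡ true
  indicator-head true _ _ = refl

  indicator-not : ∀ g → bool→ℕ (not g) ≡ 0 → g ≡ true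
  indicator-not true _ = refl

  module _ {n : ℕ} {i j : Fin n} where

    <ᵇ-true : toℕ i < toℕ j → i <ᵇ j ≡ true
    <ᵇ-true = dec-true (suc (toℕ i) ℕ.≤? toℕ j)

    <ᵇ-false : ¬ toℕ i < toℕ j → i <ᵇ j ≡ false
    <ᵇ-false = dec-false (suc (toℕ i) ℕ.≤? toℕ j)

    ≠ᵇ-true : toℕ i ≢ toℕ j → i ≠ᵇ j ≡ true
    ≠ᵇ-true p = cong (if_then false else true) (dec-false (toℕ i ℕ.≟ toℕ j) p)

    ≠ᵇ-false : toℕ i ≡ toℕ j → i ≠ᵇ j ≡ false
    ≠ᵇ-false p = cong (if_then false else true) (dec-true (toℕ i ℕ.≟ toℕ j) p)

    ≢⇒≠ᵇ : i ≢ j → i ≠ᵇ j ≡ true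
    ≢⇒≠ᵇ i≢j = ≠ᵇ-true (i≢j ∘ toℕ-injective)

    ≠ᵇ⇒≢ : i ≠ᵇ j ≡ true → i ≢ j
    ≠ᵇ⇒≢ p i≡j = contradiction (trans (sym p) (≠ᵇ-false (cong toℕ i≡j))) λ ()

  ≠ᵇ-split : ∀ {n} (i j : Fin n) → bool→ℕ (i ≠ᵇ j) ≡ bool→ℕ (i <ᵇ j) + bool→ℕ (j <ᵇ i)
  ≠ᵇ-split i j with <-cmp (toℕ i) (toℕ j)
  ... | tri< lt ne ¬gt rewrite ≠ᵇ-true ne | <ᵇ-true lt | <ᵇ-false ¬gt = refl
  ... | tri≈ ¬lt eq ¬gt rewrite ≠ᵇ-false eq | <ᵇ-false ¬lt | <ᵇ-false ¬gt = refl
  ... | tri> ¬lt ne gt rewrite ≠ᵇ-true ne | <ᵇ-false ¬lt | <ᵇ-true gt = refl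

  coord-sym : ∀ {a} {A : Set a} {n} (y : Fin n → Fin n → A) i j → coord y i j ≡ coord y j i
  coord-sym y i j with <-cmp (toℕ i) (toℕ j)
  ... | tri< lt _ ¬gt rewrite <ᵇ-true lt | <ᵇ-false ¬gt = refl
  ... | tri> ¬lt _ gt rewrite <ᵇ-false ¬lt | <ᵇ-true gt = refl
  ... | tri≈ _ eq _ with toℕ-injective eq
  ...   | refl = refl

  coord-< : ∀ {a} {A : Set a} {n} (y : Fin n → Fin n → A) {i j} → i <ᵇ j ≡ true → coord y i j ≡ y i j
  coord-< y {i} {j} i<j = cong (λ b → if b then y i j else y j i) i<j

  term≤∑ : ∀ {n} (f : Fin n → ℕ) i → f i ≤ ∑ℕ f
  term≤∑ f fzero     = m≤m+n _ _
  term≤∑ f (fsuc i)  = ≤-trans (term≤∑ (f ∘ fsuc) i) (m≤n+m _ _)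

  pair≤∑ : ∀ {n} (f : Fin n → ℕ) {a b} → a ≢ b → f a + f b ≤ ∑ℕ f
  pair≤∑ f {fzero}  {fzero}  a≢b = ⊥-elim (a≢b refl)
  pair≤∑ f {fzero}  {fsuc b} _   = +-monoʳ-≤ (f fzero) (term≤∑ (f ∘ fsuc) b)
  pair≤∑ f {fsuc a} {fzero}  _   =
    subst (_≤ ∑ℕ f) (+-comm (f fzero) (f (fsuc a))) (+-monoʳ-≤ (f fzero) (term≤∑ (f ∘ fsuc) a))
  pair≤∑ f {fsuc a} {fsuc b} a≢b = ≤-trans (pair≤∑ (f ∘ fsuc) (a≢b ∘ cong fsuc)) (m≤n+m _ _)

  ∑ℕ-mono : ∀ {n} {f g : Fin n → ℕ} → (∀ i → f i ≤ g i) → ∑ℕ f ≤ ∑ℕ g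
  ∑ℕ-mono {zero}  _ = z≤n
  ∑ℕ-mono {suc n} h = +-mono-≤ (h fzero) (∑ℕ-mono (h ∘ fsuc))

  at-most-one-positive : ∀ {n} (f : Fin n → ℕ) (d : Fin n) → ∑ℕ f ≤ 1 →
    ∃[ l ] ((l ≡ d ⊎ 1 ≤ f l) × (∀ j → j ≢ l → f j ≡ 0))
  at-most-one-positive f d small with any? (λ l → 1 ≤? f l)
  ... | yes (l , pos) = l , inj₂ pos , vanish
    where
    vanish : ∀ j → j ≢ l → f j ≡ 0
    vanish j j≢l = n≤0⇒n≡0 (+-cancelʳ-≤ 1 (f j) 0
      (≤-trans (+-monoʳ-≤ (f j) pos) (≤-trans (pair≤∑ f j≢l) small)))
  ... | no none = d , inj₁ refl , λ j _ → n<1⇒n≡0 (≰⇒> (λ pos → none (j , pos)))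

  edge-count-gap : ∀ t e → 1 ≤ t → e + e + 3 * t ≤ t * t → e < ((t ∸ 1) * (t ∸ 2)) / 2
  edge-count-gap (suc zero) e _ h = contradiction (subst (_≤ 1) (three+ e) h) λ { (s≤s ()) }
    where
    three+ : ∀ e → e + e + 3 * 1 ≡ suc (suc (suc (e + e)))
    three+ = solve-∀
  edge-count-gap (suc (suc u)) e _ h = begin
    suc e                   ≡⟨ sym (m*n/n≡m (suc e) 2) ⟩
    (suc e * 2) / 2         ≤⟨ /-monoˡ-≤ 2 doubled ⟩
    (suc u * u) / 2         ∎
    where
    open ≤-Reasoning
    lhs : ∀ e u → e + e + 3 * suc (suc u) ≡ suc e * 2 + (3 * u + 4)
    lhs = solve-∀
    rhs : ∀ u → suc (suc u) * suc (suc u) ≡ suc u * u + (3 * u + 4)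
    rhs = solve-∀
    doubled : suc e * 2 ≤ suc u * u
    doubled = +-cancelʳ-≤ (3 * u + 4) _ _ (subst₂ _≤_ (lhs e u) (rhs u) h)

  module Counting {n : ℕ} (S : Fin n → Bool) where

    size : ℕ
    size = ∑ℕ λ j → bool→ℕ (S j)

    module _ (G : Fin n → Fin n → Bool) where

      innerEdges : ℕ
      innerEdges = ∑ℕ λ i → ∑ℕ λ j → bool→ℕ (i <ᵇ j ∧ S i ∧ S j ∧ G i j)

      missed : Fin n → Fin n → ℕ
      missed i j = bool→ℕ (S j ∧ i ≠ᵇ j ∧ not (G i j))

      degree nonDegree : Fin n → ℕ
      degree    i = ∑ℕ λ j → bool→ℕ (S j ∧ i ≠ᵇ j ∧ G i j)
      nonDegree i = ∑ℕ (missed i)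

      edge : Fin n → Fin n → ℕ
      edge i j = bool→ℕ (i <ᵇ j ∧ S i ∧ S j ∧ G i j)

      both-orders : (∀ i j → G i j ≡ G j i) →
        ∀ i j → bool→ℕ (S i) * bool→ℕ (S j ∧ i ≠ᵇ j ∧ G i j) ≡ edge i j + edge j i
      both-orders G-sym i j = begin
        ⟦ S i ⟧ * ⟦ S j ∧ i ≠ᵇ j ∧ G i j ⟧
          ≡⟨ cong (⟦ S i ⟧ *_) (bool→ℕ-∧₃ (S j) (i ≠ᵇ j) (G i j)) ⟩
        ⟦ S i ⟧ * (⟦ S j ⟧ * (⟦ i ≠ᵇ j ⟧ * ⟦ G i j ⟧))
          ≡⟨ cong (λ d → ⟦ S i ⟧ * (⟦ S j ⟧ * (d * ⟦ G i j ⟧))) (≠ᵇ-split i j) ⟩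
        ⟦ S i ⟧ * (⟦ S j ⟧ * ((⟦ i <ᵇ j ⟧ + ⟦ j <ᵇ i ⟧) * ⟦ G i j ⟧))
          ≡⟨ regroup ⟦ S i ⟧ ⟦ S j ⟧ ⟦ i <ᵇ j ⟧ ⟦ j <ᵇ i ⟧ ⟦ G i j ⟧ ⟩
        ⟦ i <ᵇ j ⟧ * (⟦ S i ⟧ * (⟦ S j ⟧ * ⟦ G i j ⟧)) + ⟦ j <ᵇ i ⟧ * (⟦ S j ⟧ * (⟦ S i ⟧ * ⟦ G i j ⟧))
          ≡⟨ cong₂ _+_ (sym (bool→ℕ-∧₄ (i <ᵇ j) (S i) (S j) (G i j)))
                       (trans (cong (λ g → ⟦ j <ᵇ i ⟧ * (⟦ S j ⟧ * (⟦ S i ⟧ * ⟦ g ⟧))) (G-sym i j))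
                              (sym (bool→ℕ-∧₄ (j <ᵇ i) (S j) (S i) (G j i)))) ⟩
        edge i j + edge j i ∎
        where
        open ≡-Reasoning
        ⟦_⟧ = bool→ℕ
        regroup : ∀ s t p q g → s * (t * ((p + q) * g)) ≡ p * (s * (t * g)) + q * (t * (s * g))
        regroup = solve-∀

      handshake : (∀ i j → G i j ≡ G j i) →
                  ∑ℕ (λ i → bool→ℕ (S i) * degree i) ≡ innerEdges + innerEdges
      handshake G-sym = begin
        ∑ℕ (λ i → bool→ℕ (S i) * degree i)
          ≡⟨ ∑ℕ-cong (λ i → *-distribˡ-∑ℕ (bool→ℕ (S i)) (λ j → bool→ℕ (S j ∧ i ≠ᵇ j ∧ G i j))) ⟩
        ∑ℕ (λ i → ∑ℕ λ j → bool→ℕ (S i) * bool→ℕ (S j ∧ i ≠ᵇ j ∧ G i j))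
          ≡⟨ ∑ℕ-cong (λ i → ∑ℕ-cong (both-orders G-sym i)) ⟩
        ∑ℕ (λ i → ∑ℕ λ j → edge i j + edge j i)
          ≡⟨ ∑ℕ-cong (λ i → ∑ℕ-distrib-+ (edge i) (λ j → edge j i)) ⟩
        ∑ℕ (λ i → ∑ℕ (edge i) + ∑ℕ λ j → edge j i)
          ≡⟨ ∑ℕ-distrib-+ (λ i → ∑ℕ (edge i)) (λ i → ∑ℕ λ j → edge j i) ⟩
        innerEdges + ∑ℕ (λ i → ∑ℕ λ j → edge j i)
          ≡⟨ cong (innerEdges +_) (∑ℕ-comm (λ i j → edge j i)) ⟩
        innerEdges + innerEdges ∎
        where open ≡-Reasoning

      -- Every j ∈ S is i, a neighbour of i, or a non-neighbour of i.
      row-bound : ∀ i → degree i + nonDegree i + bool→ℕ (S i) ≤ size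
      row-bound i = begin
        degree i + nonDegree i + bool→ℕ (S i)
          ≤⟨ +-monoʳ-≤ (degree i + nonDegree i) (subst (_≤ ∑ℕ self) self-i (term≤∑ self i)) ⟩
        degree i + nonDegree i + ∑ℕ self
          ≡⟨ cong (_+ ∑ℕ self) (∑ℕ-distrib-+ (λ j → bool→ℕ (S j ∧ i ≠ᵇ j ∧ G i j)) (missed i)) ⟨
        ∑ℕ (λ j → bool→ℕ (S j ∧ i ≠ᵇ j ∧ G i j) + missed i j) + ∑ℕ self
          ≡⟨ ∑ℕ-distrib-+ (λ j → bool→ℕ (S j ∧ i ≠ᵇ j ∧ G i j) + missed i j) self ⟨
        ∑ℕ (λ j → bool→ℕ (S j ∧ i ≠ᵇ j ∧ G i j) + missed i j + self j)
          ≡⟨ ∑ℕ-cong (λ j → indicator-partition (S j) (i ≠ᵇ j) (G i j)) ⟩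
        size ∎
        where
        open ≤-Reasoning
        self : Fin n → ℕ
        self j = bool→ℕ (not (i ≠ᵇ j) ∧ S j)
        self-i : self i ≡ bool→ℕ (S i)
        self-i = cong (λ b → bool→ℕ (not b ∧ S i)) (≠ᵇ-false {i = i} refl)

      sparse : (∀ i j → G i j ≡ G j i) → (∀ i → S i ≡ true → 2 ≤ nonDegree i) →
               innerEdges + innerEdges + 3 * size ≤ size * size
      sparse G-sym missing = begin
        innerEdges + innerEdges + 3 * size
          ≡⟨ cong₂ _+_ (sym (handshake G-sym)) (*-distribˡ-∑ℕ 3 (λ i → bool→ℕ (S i))) ⟩
        ∑ℕ (λ i → bool→ℕ (S i) * degree i) + ∑ℕ (λ i → 3 * bool→ℕ (S i))
          ≡⟨ ∑ℕ-distrib-+ (λ i → bool→ℕ (S i) * degree i) (λ i → 3 * bool→ℕ (S i)) ⟨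
        ∑ℕ (λ i → bool→ℕ (S i) * degree i + 3 * bool→ℕ (S i))
          ≤⟨ ∑ℕ-mono vertex ⟩
        ∑ℕ (λ i → bool→ℕ (S i) * size)
          ≡⟨ *-distribʳ-∑ℕ size (λ i → bool→ℕ (S i)) ⟨
        size * size ∎
        where
        open ≤-Reasoning
        vertex : ∀ i → bool→ℕ (S i) * degree i + 3 * bool→ℕ (S i) ≤ bool→ℕ (S i) * size
        vertex i with S i in Si
        ... | false = z≤n
        ... | true  = begin
          1 * degree i + 3                      ≡⟨ cong (_+ 3) (*-identityˡ (degree i)) ⟩
          degree i + (2 + 1)                    ≤⟨ +-monoʳ-≤ (degree i) (+-monoˡ-≤ 1 (missing i Si)) ⟩
          degree i + (nonDegree i + 1)          ≡⟨ +-assoc (degree i) (nonDegree i) 1 ⟨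
          degree i + nonDegree i + bool→ℕ true  ≡⟨ cong (λ b → degree i + nonDegree i + bool→ℕ b) Si ⟨
          degree i + nonDegree i + bool→ℕ (S i) ≤⟨ row-bound i ⟩
          size                                  ≡⟨ *-identityˡ size ⟨
          1 * size                              ∎

      universal-but-one : ∀ i → S i ≡ true → nonDegree i ≤ 1 →
        ∃[ l ] (S l ≡ true × (∀ j → S j ≡ true → i ≢ j → j ≢ l → G i j ≡ true))
      universal-but-one i Si few with at-most-one-positive (missed i) i few
      ... | l , l≡i⊎missed , vanish = l , member l≡i⊎missed , adjacent
        where
        member : l ≡ i ⊎ 1 ≤ missed i l → S l ≡ true
        member (inj₁ refl) = Si
        member (inj₂ pos)  = indicator-head (S l) _ pos
        adjacent : ∀ j → S j ≡ true → i ≢ j → j ≢ l → G i j ≡ true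
        adjacent j Sj i≢j j≢l = indicator-not (G i j)
          (trans (sym (cong₂ (λ s d → bool→ℕ (s ∧ d ∧ not (G i j))) Sj (≢⇒≠ᵇ i≢j))) (vanish j j≢l))

      nearly-universal : (∀ i j → G i j ≡ G j i) → ∀ {i₀} → S i₀ ≡ true →
        ((size ∸ 1) * (size ∸ 2)) / 2 ≤ innerEdges →
        ∃[ i ] (S i ≡ true × ∃[ l ] (S l ≡ true × (∀ j → S j ≡ true → i ≢ j → j ≢ l → G i j ≡ true)))
      nearly-universal G-sym {i₀} Si₀ dense with any? (λ i → (S i ≟ᵇ true) ×-dec (nonDegree i ≤? 1))
      ... | yes (i , Si , few) = i , Si , universal-but-one i Si few
      ... | no none = contradiction dense (<⇒≱ (edge-count-gap size innerEdges nonempty (sparse G-sym missing)))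
        where
        nonempty : 1 ≤ size
        nonempty = subst (_≤ size) (cong bool→ℕ Si₀) (term≤∑ _ i₀)
        missing : ∀ i → S i ≡ true → 2 ≤ nonDegree i
        missing i Si = ≰⇒> (λ few → none (i , Si , few))

  ∣∣≡size : ∀ {n} (T : Subset n) → ∣ T ∣ ≡ Counting.size (_∈ᵇ T)
  ∣∣≡size []          = refl
  ∣∣≡size (true ∷ T)  = cong suc (∣∣≡size T)
  ∣∣≡size (false ∷ T) = ∣∣≡size T

  x∈p─q⇒x∉q : ∀ {n} (p q : Subset n) {x} → x ∈ p ─ q → x ∉ q
  x∈p─q⇒x∉q (_ ∷ p) (outside ∷ q) here       ()
  x∈p─q⇒x∉q (_ ∷ p) (outside ∷ q) (there x∈) (there x∈q) = x∈p─q⇒x∉q p q x∈ x∈q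
  x∈p─q⇒x∉q (_ ∷ p) (inside  ∷ q) (there x∈) (there x∈q) = x∈p─q⇒x∉q p q x∈ x∈q

  ∈ᵇ-∖ : ∀ {n} (T : Subset n) (l j : Fin n) → j ∈ᵇ (T ∖ l) ≡ true → j ∈ᵇ T ≡ true × j ≢ l
  ∈ᵇ-∖ T l j p = []=⇒lookup (p─q⊆p T ⁅ l ⁆ j∈) , λ { refl → x∈p─q⇒x∉q T ⁅ l ⁆ j∈ (x∈⁅x⁆ l) }
    where
    j∈ : j ∈ T ∖ l
    j∈ = lookup⇒[]= j (T ∖ l) p

  innerEdgesIn : ∀ {n} → Subset n → (Fin n → Fin n → Bool) → ℕ
  innerEdgesIn T y = Counting.innerEdges (_∈ᵇ T) (coord y)

  dense-point : ∀ {n} (T : Subset n) (y : Fin n → Fin n → Bool) → Nonempty T →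
    ((∣ T ∣ ∸ 1) * (∣ T ∣ ∸ 2)) / 2 ≤ innerEdgesIn T y →
    ∃[ i ] ∃[ l ] (l ∈ T × (∀ j → j ∈ᵇ (T ∖ l) ≡ true → i ≢ j → bool→ℕ (coord y i j) ≡ 1))
  dense-point T y (i₀ , i₀∈T) dense
    with Counting.nearly-universal (_∈ᵇ T) (coord y) (coord-sym y) ([]=⇒lookup i₀∈T)
           (subst (λ t → ((t ∸ 1) * (t ∸ 2)) / 2 ≤ innerEdgesIn T y) (∣∣≡size T) dense)
  ... | i , _ , l , l∈T , adjacent = i , l , lookup⇒[]= l T l∈T , adjacent′
    where
    adjacent′ : ∀ j → j ∈ᵇ (T ∖ l) ≡ true → i ≢ j → bool→ℕ (coord y i j) ≡ 1
    adjacent′ j j∈T∖l i≢j = let (j∈T , j≢l) = ∈ᵇ-∖ T l j j∈T∖l in cong bool→ℕ (adjacent j j∈T i≢j j≢l)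

open Combinatorics

module OrderedFieldFacts {c ℓ₁ ℓ₂} (𝔽 : OrderedField c ℓ₁ ℓ₂) where

  open OrderedField 𝔽 renaming (refl to ≈-refl; sym to ≈-sym; trans to ≈-trans)
  open IsTotalOrder isTotalOrder using (total; antisym; isPartialOrder)
    renaming (refl to ≤-refl; trans to ≤-trans; reflexive to ≤-reflexive;
              ≲-respˡ-≈ to ≤-respˡ-≈; ≲-respʳ-≈ to ≤-respʳ-≈)
  open SemiringSum semiring using (sum-cong-≋; ∑-distrib-+; *-distribˡ-sum; sum-replicate-zero)
    renaming (sum to ∑)
  open SemiringSum Data.Nat.Properties.+-*-semiring using () renaming (sum to ∑ℕ)
  open import Algebra.Properties.Ring (CommutativeRing.ring ring) using (-1*x≈-x; -‿involutive)

  poset : Poset c ℓ₁ ℓ₂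
  poset = record { isPartialOrder = isPartialOrder }

  ≡⇒≈ : ∀ {a b} → a ≡ b → a ≈ b
  ≡⇒≈ refl = ≈-refl

  ≤-resp : ∀ {a b a′ b′} → a ≈ a′ → b ≈ b′ → a ≤ b → a′ ≤ b′
  ≤-resp a≈a′ b≈b′ = ≤-respˡ-≈ a≈a′ ∘ ≤-respʳ-≈ b≈b′

  +-monoˡ-≤ : ∀ {x y} z → x ≤ y → (z + x) ≤ (z + y)
  +-monoˡ-≤ {x} {y} z = ≤-resp (+-comm x z) (+-comm y z) ∘ +-mono-≤ z

  +-mono₂-≤ : ∀ {a b c′ d} → a ≤ b → c′ ≤ d → (a + c′) ≤ (b + d)
  +-mono₂-≤ {b = b} {c′ = c′} a≤b c′≤d = ≤-trans (+-mono-≤ c′ a≤b) (+-monoˡ-≤ b c′≤d)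

  -- 0 ≤ 1: if 1 ≤ 0 then 0 ≤ -1, so 0 ≤ (-1)(-1) = 1 anyway.
  0≤1 : 0# ≤ 1#
  0≤1 with total 0# 1#
  ... | inj₁ 0≤1 = 0≤1
  ... | inj₂ 1≤0 = ≤-respʳ-≈ (≈-trans (-1*x≈-x (- 1#)) (-‿involutive 1#)) (*-nonneg 0≤-1 0≤-1)
    where
    0≤-1 : 0# ≤ (- 1#)
    0≤-1 = ≤-resp (-‿inverseʳ 1#) (+-identityˡ (- 1#)) (+-mono-≤ (- 1#) 1≤0)

  1+x≰x : ∀ x → ¬ ((1# + x) ≤ x)
  1+x≰x x 1+x≤x = 0≉1 (antisym 0≤1 (≤-resp cancel (-‿inverseʳ x) (+-mono-≤ (- x) 1+x≤x)))
    where
    cancel : (1# + x) + - x ≈ 1#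
    cancel = ≈-trans (+-assoc 1# x (- x)) (≈-trans (+-congˡ (-‿inverseʳ x)) (+-identityʳ 1#))

  *-monoˡ-≤ : ∀ {x y a} → 0# ≤ a → x ≤ y → (a * x) ≤ (a * y)
  *-monoˡ-≤ {x} {y} {a} 0≤a x≤y = ≤-resp (+-identityˡ (a * x)) split (+-mono-≤ (a * x) 0≤a[y-x])
    where
    0≤a[y-x] : 0# ≤ (a * (y + - x))
    0≤a[y-x] = *-nonneg 0≤a (≤-respˡ-≈ (-‿inverseʳ x) (+-mono-≤ (- x) x≤y))
    split : a * (y + - x) + a * x ≈ a * y
    split = ≈-trans (≈-sym (distribˡ a (y + - x) x))
                  (*-congˡ (≈-trans (+-assoc y (- x) x) (≈-trans (+-congˡ (-‿inverseˡ x)) (+-identityʳ y))))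

  fromℕ-nonneg : ∀ m → 0# ≤ fromℕ m
  fromℕ-nonneg zero    = ≤-refl
  fromℕ-nonneg (suc m) = ≤-respˡ-≈ (+-identityʳ 0#) (+-mono₂-≤ 0≤1 (fromℕ-nonneg m))

  fromℕ-mono : ∀ {m m′} → m ℕ.≤ m′ → fromℕ m ≤ fromℕ m′
  fromℕ-mono {m′ = m′} z≤n = fromℕ-nonneg m′
  fromℕ-mono (s≤s m≤m′)   = +-monoˡ-≤ 1# (fromℕ-mono m≤m′)

  fromℕ-+ : ∀ m m′ → fromℕ (m ℕ.+ m′) ≈ fromℕ m + fromℕ m′
  fromℕ-+ zero    m′ = ≈-sym (+-identityˡ (fromℕ m′))
  fromℕ-+ (suc m) m′ = ≈-trans (+-congˡ (fromℕ-+ m m′)) (≈-sym (+-assoc 1# (fromℕ m) (fromℕ m′)))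

  ind≈fromℕ : ∀ b → ind b ≈ fromℕ (bool→ℕ b)
  ind≈fromℕ true  = ≈-sym (+-identityʳ 1#)
  ind≈fromℕ false = ≈-refl

  sumV≈∑ : ∀ {n} (f : Fin n → Carrier) → sumV f ≈ ∑ f
  sumV≈∑ {zero}  f = ≈-refl
  sumV≈∑ {suc n} f = +-congˡ (≈-trans (≡⇒≈ (cong (foldr _+_ 0#) shift)) (sumV≈∑ (f ∘ fsuc)))
    where
    shift : map f (tabulate fsuc) ≡ map (f ∘ fsuc) (allFin n)
    shift = trans (map-tabulate fsuc f) (sym (map-tabulate (λ i → i) (f ∘ fsuc)))

  ∑-cong : ∀ {n} {f g : Fin n → Carrier} → (∀ i → f i ≈ g i) → ∑ f ≈ ∑ g
  ∑-cong = sum-cong-≋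

  ∑-mono : ∀ {n} {f g : Fin n → Carrier} → (∀ i → f i ≤ g i) → ∑ f ≤ ∑ g
  ∑-mono {zero}  _ = ≤-refl
  ∑-mono {suc n} h = +-mono₂-≤ (h fzero) (∑-mono (h ∘ fsuc))

  ∑-delta : ∀ {n} (i : Fin n) (f : Fin n → Carrier) → ∑ (λ j → if i ≠ᵇ j then 0# else f j) ≈ f i
  ∑-delta {suc n} fzero    f = ≈-trans (+-congˡ (sum-replicate-zero n)) (+-identityʳ (f fzero))
  ∑-delta {suc n} (fsuc i) f = ≈-trans (+-identityˡ _) (∑-delta i (f ∘ fsuc))

  fromℕ-∑ : ∀ {n} (f : Fin n → ℕ) → fromℕ (∑ℕ f) ≈ ∑ (fromℕ ∘ f)
  fromℕ-∑ {zero}  f = ≈-refl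
  fromℕ-∑ {suc n} f = ≈-trans (fromℕ-+ (f fzero) _) (+-congˡ (fromℕ-∑ (f ∘ fsuc)))

  module Combinations {y} {Y : Set y} where

    weighted : List (Carrier × Y) → (Y → Carrier) → Carrier
    weighted []             g = 0#
    weighted ((a , p) ∷ cs) g = a * g p + weighted cs g

    foldr≈weighted : (f : Carrier × Y → Carrier → Carrier) (g : Y → Carrier) →
      (∀ a p acc → f (a , p) acc ≈ a * g p + acc) → ∀ cs → foldr f 0# cs ≈ weighted cs g
    foldr≈weighted f g step []             = ≈-refl
    foldr≈weighted f g step ((a , p) ∷ cs) = ≈-trans (step a p _) (+-congˡ (foldr≈weighted f g step cs))

    weighted-cong : ∀ cs {g h : Y → Carrier} → (∀ p → g p ≈ h p) → weighted cs g ≈ weighted cs h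
    weighted-cong []             _   = ≈-refl
    weighted-cong ((a , p) ∷ cs) g≈h = +-cong (*-congˡ (g≈h p)) (weighted-cong cs g≈h)

    weighted-zero : ∀ cs → weighted cs (λ _ → 0#) ≈ 0#
    weighted-zero []             = ≈-refl
    weighted-zero ((a , _) ∷ cs) = ≈-trans (+-cong (zeroʳ a) (weighted-zero cs)) (+-identityʳ 0#)

    weighted-+ : ∀ cs (g h : Y → Carrier) → weighted cs (λ p → g p + h p) ≈ weighted cs g + weighted cs h
    weighted-+ []             g h = ≈-sym (+-identityʳ 0#)
    weighted-+ ((a , p) ∷ cs) g h = ≈-trans (+-cong (distribˡ a (g p) (h p)) (weighted-+ cs g h))
                                            (middle-swap (a * g p) (a * h p) (weighted cs g) (weighted cs h))
      where
      middle-swap : ∀ u v u′ v′ → (u + v) + (u′ + v′) ≈ (u + u′) + (v + v′)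
      middle-swap u v u′ v′ = ≈-trans (+-assoc u v (u′ + v′)) (≈-trans (+-congˡ (≈-trans (≈-sym (+-assoc v u′ v′))
        (≈-trans (+-congʳ (+-comm v u′)) (+-assoc u′ v v′)))) (≈-sym (+-assoc u u′ (v + v′))))

    weighted-const : ∀ cs k → weighted cs (λ _ → k) ≈ weighted cs (λ _ → 1#) * k
    weighted-const []             k = ≈-sym (zeroˡ k)
    weighted-const ((a , _) ∷ cs) k =
      ≈-trans (+-cong (*-congʳ (≈-sym (*-identityʳ a))) (weighted-const cs k)) (≈-sym (distribʳ k (a * 1#) _))

    weighted-mono : ∀ {g h : Y → Carrier} cs →
      All (λ c → 0# ≤ proj₁ c × g (proj₂ c) ≤ h (proj₂ c)) cs → weighted cs g ≤ weighted cs h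
    weighted-mono []       []                    = ≤-refl
    weighted-mono (_ ∷ cs) ((0≤a , g≤h) ∷ rest) = +-mono₂-≤ (*-monoˡ-≤ 0≤a g≤h) (weighted-mono cs rest)

    ∑-weighted : ∀ {n} cs (g : Fin n → Y → Carrier) →
      ∑ (λ i → weighted cs (g i)) ≈ weighted cs (λ p → ∑ (λ i → g i p))
    ∑-weighted {n} []             g = sum-replicate-zero n
    ∑-weighted     ((a , p) ∷ cs) g =
      ≈-trans (∑-distrib-+ (λ i → a * g i p) (λ i → weighted cs (g i)))
              (+-cong (≈-sym (*-distribˡ-sum a (λ i → g i p))) (∑-weighted cs g))

    gate : ∀ b {v} cs (g : Y → Bool) → (b ≡ true → v ≈ weighted cs (ind ∘ g)) →
           (if b then v else 0#) ≈ weighted cs (λ p → ind (b ∧ g p))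
    gate false cs g _ = ≈-sym (weighted-zero cs)
    gate true  cs g h = h refl

    point-above-mean : ∀ {p} {P : Carrier × Y → Set p} (g : Y → ℕ) (r : ℕ) cs → All P cs →
      (∀ {c} → P c → 0# ≤ proj₁ c) → weighted cs (λ _ → 1#) ≈ 1# → weighted cs (fromℕ ∘ g) ≈ fromℕ r →
      ∃[ c ] (P c × r ℕ.≤ g (proj₂ c))
    point-above-mean g r cs ps nonneg mass mean with Any.any? (λ c → r ≤? g (proj₂ c)) cs
    ... | yes found = Any.lookup found , lookupAny ps found
    ... | no  none  = ⊥-elim (1+x≰x (fromℕ r) (≤-resp above below (weighted-mono cs bounds)))
      where
      bounds : All (λ c → 0# ≤ proj₁ c × fromℕ (suc (g (proj₂ c))) ≤ fromℕ r) cs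
      bounds = zipWith (λ { (Pc , r≰g) → nonneg Pc , fromℕ-mono (≰⇒> r≰g) }) (ps , ¬Any⇒All¬ cs none)
      above : weighted cs (fromℕ ∘ suc ∘ g) ≈ 1# + fromℕ r
      above = ≈-trans (weighted-+ cs (λ _ → 1#) (fromℕ ∘ g)) (+-cong mass mean)
      below : weighted cs (λ _ → fromℕ r) ≈ fromℕ r
      below = ≈-trans (weighted-const cs (fromℕ r)) (≈-trans (*-congʳ mass) (*-identityˡ (fromℕ r)))

  open Combinations
  open Polytope 𝔽 using (wt; sumET)

  sumV≈∑₂ : ∀ {n} (F : Fin n → Fin n → Carrier) → sumV (λ i → sumV (F i)) ≈ ∑ (λ i → ∑ (F i))
  sumV≈∑₂ F = ≈-trans (sumV≈∑ (λ i → sumV (F i))) (∑-cong (λ i → sumV≈∑ (F i)))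

  face-functional : ∀ {n} (T : Subset n) (x : Fin n → Fin n → Carrier) cs →
    (∀ i j → i <ᵇ j ≡ true → x i j ≈ weighted cs (λ y → ind (y i j))) →
    sumET T x ≈ weighted cs (λ y → fromℕ (innerEdgesIn T y))
  face-functional {n} T x cs x≈ = begin
    sumET T x
      ≈⟨ sumV≈∑₂ (λ i j → if i <ᵇ j then (if i ∈ᵇ T then (if j ∈ᵇ T then x i j else 0#) else 0#) else 0#) ⟩
    ∑ (λ i → ∑ λ j → if i <ᵇ j then (if i ∈ᵇ T then (if j ∈ᵇ T then x i j else 0#) else 0#) else 0#)
      ≈⟨ ∑-cong (λ i → ∑-cong (gated i)) ⟩
    ∑ (λ i → ∑ λ j → weighted cs (λ y → ind (edge y i j)))
      ≈⟨ ∑-cong (λ i → ∑-weighted cs (λ j y → ind (edge y i j))) ⟩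
    ∑ (λ i → weighted cs (λ y → ∑ λ j → ind (edge y i j)))
      ≈⟨ ∑-weighted cs (λ i y → ∑ λ j → ind (edge y i j)) ⟩
    weighted cs (λ y → ∑ λ i → ∑ λ j → ind (edge y i j))
      ≈⟨ weighted-cong cs count ⟩
    weighted cs (λ y → fromℕ (innerEdgesIn T y)) ∎
    where
    open SetoidReasoning setoid
    edge : (Fin n → Fin n → Bool) → Fin n → Fin n → Bool
    edge y i j = i <ᵇ j ∧ i ∈ᵇ T ∧ j ∈ᵇ T ∧ coord y i j
    gated : ∀ i j → (if i <ᵇ j then (if i ∈ᵇ T then (if j ∈ᵇ T then x i j else 0#) else 0#) else 0#)
                    ≈ weighted cs (λ y → ind (edge y i j))
    gated i j =
      gate (i <ᵇ j) cs (λ y → i ∈ᵇ T ∧ j ∈ᵇ T ∧ coord y i j) λ i<j →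
      gate (i ∈ᵇ T) cs (λ y → j ∈ᵇ T ∧ coord y i j) λ _ →
      gate (j ∈ᵇ T) cs (λ y → coord y i j) λ _ →
      ≈-trans (x≈ i j i<j) (weighted-cong cs (λ y → ≡⇒≈ (cong ind (sym (coord-< y i<j)))))
    count : ∀ y → ∑ (λ i → ∑ λ j → ind (edge y i j)) ≈ fromℕ (innerEdgesIn T y)
    count y = ≈-trans (∑-cong (λ i → ≈-trans (∑-cong (λ j → ind≈fromℕ (edge y i j)))
                                             (≈-sym (fromℕ-∑ (λ j → bool→ℕ (edge y i j))))))
                      (≈-sym (fromℕ-∑ (λ i → ∑ℕ λ j → bool→ℕ (edge y i j))))

  neighbourhood-weight : ∀ {n} (w : Fin n → Carrier) → (∀ j → 0# ≤ w j) →
    (U : Subset n) (i : Fin n) (a : Fin n → ℕ) → (∀ j → j ∈ᵇ U ≡ true → i ≢ j → a j ≡ 1) →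
    wt w U ≤ (w i + sumV (λ j → if i ≠ᵇ j then w j * fromℕ (a j) else 0#))
  neighbourhood-weight {n} w w≥0 U i a adj = begin
    wt w U                                                     ≈⟨ sumV≈∑ (λ j → if j ∈ᵇ U then w j else 0#) ⟩
    ∑ (λ j → if j ∈ᵇ U then w j else 0#)                       ≤⟨ ∑-mono pointwise ⟩
    ∑ (λ j → (if i ≠ᵇ j then 0# else w j) + h j)               ≈⟨ ∑-distrib-+ _ h ⟩
    ∑ (λ j → if i ≠ᵇ j then 0# else w j) + ∑ h                 ≈⟨ +-cong (∑-delta i w) (≈-sym (sumV≈∑ h)) ⟩
    w i + sumV h                                               ∎
    where
    open PosetReasoning poset
    h : Fin n → Carrier
    h j = if i ≠ᵇ j then w j * fromℕ (a j) else 0#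
    pointwise : ∀ j → (if j ∈ᵇ U then w j else 0#) ≤
                      ((if i ≠ᵇ j then 0# else w j) + (if i ≠ᵇ j then w j * fromℕ (a j) else 0#))
    pointwise j with i ≠ᵇ j in i≠j | j ∈ᵇ U in j∈U
    ... | false | true  = ≤-reflexive (≈-sym (+-identityʳ (w j)))
    ... | false | false = ≤-respʳ-≈ (≈-sym (+-identityʳ (w j))) (w≥0 j)
    ... | true  | false = ≤-respʳ-≈ (≈-sym (+-identityˡ _)) (*-nonneg (w≥0 j) (fromℕ-nonneg (a j)))
    ... | true  | true  = ≤-reflexive (≈-sym (begin-equality
      0# + w j * fromℕ (a j)  ≈⟨ +-identityˡ _ ⟩
      w j * fromℕ (a j)       ≈⟨ *-congˡ (≡⇒≈ (cong fromℕ (adj j j∈U (≠ᵇ⇒≢ i≠j)))) ⟩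
      w j * (1# + 0#)         ≈⟨ *-congˡ (+-identityʳ 1#) ⟩
      w j * 1#                ≈⟨ *-identityʳ (w j) ⟩
      w j                     ∎))

  heavy⇒nonempty : ∀ {n} (w : Fin n → Carrier) {W_L W_U} (T : Subset n) →
    0# < W_L → W_L ≤ W_U → W_U < wt w T → Nonempty T
  heavy⇒nonempty {n} w {W_U = W_U} T (0≤W_L , 0≉W_L) W_L≤W_U (W_U≤wT , _) with nonempty? T
  ... | yes nonempty = nonempty
  ... | no  empty    = ⊥-elim (0≉W_L (antisym 0≤W_L (≤-trans W_L≤W_U (≤-respʳ-≈ weightless W_U≤w⊥))))
    where
    W_U≤w⊥ : W_U ≤ wt w ⊥
    W_U≤w⊥ = subst (λ U → W_U ≤ wt w U) (Empty-unique empty) W_U≤wT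
    weightless : wt w ⊥ ≈ 0#
    weightless = ≈-trans (sumV≈∑ (λ j → if j ∈ᵇ ⊥ then w j else 0#)) (≈-trans
      (∑-cong (λ j → ≡⇒≈ (cong (λ b → if b then w j else 0#) (lookup-replicate j outside))))
      (sum-replicate-zero n))

proposition4 : ∀ {c ℓ₁ ℓ₂} (𝔽 : OrderedField c ℓ₁ ℓ₂) →
    let open Polytope 𝔽 in
    (n k : ℕ) .{{_ : ℕ.NonZero k}} →
    2 ℕ.≤ k → 2 ℕ.≤ Params.F_L n k →
    (w : Fin n → Carrier) → (∀ i → 0# < w i) →
    (W_L W_U : Carrier) → 0# < W_L → W_L ≤ W_U →
    (T : Subset n) → W_U < wt w T →
    (∃[ x ] InFace n k w W_L W_U T x) →
    ∃[ l ] ((l ∈ T) × (wt w (T ∖ l) ≤ W_U))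
proposition4 𝔽 n k _ _ w w>0 W_L W_U 0<W_L W_L≤W_U T W_U<wT (x , (comb , points , mass , x≈) , tight) =
  let
      ((_ , y) , (_ , feasible) , dense) =
        point-above-mean (innerEdgesIn T) (rhsWC T) comb points proj₁ mass′ mean
      (i , l , l∈T , adjacent) = dense-point T y (heavy⇒nonempty w T 0<W_L W_L≤W_U W_U<wT) dense
  in  l , l∈T , ≤-trans (neighbourhood-weight w (proj₁ ∘ w>0) (T ∖ l) i _ adjacent) (Feasible.wU feasible i)
  where
  open Polytope 𝔽 renaming (refl to ≈-refl; sym to ≈-sym; trans to ≈-trans)
  open IsTotalOrder isTotalOrder using () renaming (trans to ≤-trans)
  open OrderedFieldFacts 𝔽
  open Combinations
  mass′ : weighted comb (λ _ → 1#) ≈ 1#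
  mass′ = ≈-trans (≈-sym (foldr≈weighted _ (λ _ → 1#) (λ a _ _ → +-congʳ (≈-sym (*-identityʳ a))) comb)) mass
  mean : weighted comb (λ y → fromℕ (innerEdgesIn T y)) ≈ fromℕ (rhsWC T)
  mean = ≈-trans (≈-sym (face-functional T x comb λ i j i<j →
                   ≈-trans (x≈ i j i<j) (foldr≈weighted _ (λ y → ind (y i j)) (λ _ _ _ → ≈-refl) comb)))
                 tight
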